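{- Let $n,a\in\mathbb{N}$, $\delta>0$, and let $H\subseteq\{0,1\}^n$ be a deterministic $\delta/(na)$-hitter for the class of functions computed by permutation branching programs of length $n$ and arbitrary (unbounded) width with a single accept state. Then for every permutation branching program $B$ of length $n$ and arbitrary width with at most $a$ accept vertices, the induced hit program $B_H$ satisfies $|\Pr[B_H(U_n)=1]-\Pr[B(U_n)=1]|\le\delta$, where $U_n$ is uniform on $\{0,1\}^n$.
   Context: A permutation branching program $B$ of length $n$ and width $w$ has layers $V_0,\dots,V_n$, each a copy of $\{1,\dots,w\}$, a start state $v_0\in V_0$, transition functions $B_r:V_{r-1}\times\{0,1\}\to V_r$ ($r=1,\dots,n$) such that each $B_r(\cdot,b)$ is a permutation, and a set $V_{\mathit{acc}}\subseteq V_n$ of accept vertices. For $v\in V_i$, $x\in\{0,1\}^k$, $i+k\le n$, $B[v,x]\in V_{i+k}$ is the state reached from $v$ reading $x$; $B(x)=1$ iff $B[v_0,x]\in V_{\mathit{acc}}$. A deterministic $\gamma$-hitter for a class $\mathcal{F}$ of functions $\{0,1\}^n\to\{0,1\}$ is a set $H\subseteq\{0,1\}^n$ such that every $f\in\mathcal{F}$ with $\Pr[f(U_n)=1]>\gamma$ has $f(x)=1$ for some $x\in H$. Induced hit program: for $i=0,\dots,n$ let $K_i=\{v\in V_i:\exists y\in H,\ B[v,y_{1..n-i}]\in V_{\mathit{acc}}\}$, let $K=\max_i|K_i|$, and pad each $K_i$ with fresh padding states to a set $K_i'$ of size $K$. Layer $i$ of $B_H$ is $W_i=K_i'\cup(\{0,\dots,n\}\times[K])$.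 Fix bijections $\iota_i:K_i'\to[K]$. The transition $W_i\to W_{i+1}$ on bit $b$ sends $v\in K_i$ to $B_{i+1}(v,b)$ if that lies in $K_{i+1}$ and to $(i,\iota_i(v))$ otherwise; sends a padding state $p$ to $(i,\iota_i(p))$; sends $(j,u)$, $j\ne i$, to $(j,u)$; and on states $(i,u)$ is defined arbitrarily so that the map is a bijection. The accept set is $K_n\cap V_{\mathit{acc}}$; the start state is $v_0$ if $v_0\in K_0$, otherwise $(n,1)$ (so $B_H$ rejects everything).
   Formalization: The parameter δ ranges over the positive rationals. -}

module Defs where

open import Data.Nat using (ℕ; zero; suc; _+_; _*_; _∸_; _^_; _≤_; _<_; _⊔_; _<?_; NonZero)
open import Data.Nat.Properties using (m^n≢0; m<n⇒m<1+n; ≤-refl; <⇒≤)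
open import Data.Bool using (Bool; true; false; T; T?)
open import Data.Fin using (Fin; toℕ; fromℕ<)
open import Data.Fin.Subset using (Subset; ∣_∣)
open import Data.Vec using (Vec; []; _∷_; lookup; tabulate; toList)
open import Data.List using (List; []; _∷_; _++_; map; filter; length; take; foldr; upTo)
open import Data.List.Relation.Unary.Any using (Any)
open import Data.Bool.ListAction using (any)
open import Data.Product using (Σ; _×_; _,_)
open import Data.Sum using (_⊎_; inj₁; inj₂)
open import Data.Maybe using (Maybe; just; nothing; maybe)
open import Data.Integer using (+_)
open import Data.Rational using (ℚ; _/_) renaming (_<_ to _<ℚ_)
open import Relation.Nullary using (¬_; yes; no)
open import Relation.Binary.PropositionalEquality using (_≡_; _≢_)
open import Function.Definitions using (Bijective)
open import Function.Bundles using (_⤖_; Bijection)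

-- Permutation branching programs of length n and width w.
-- Every layer V_0..V_n is a copy of Fin w.  trans r (r : Fin n, i.e.
-- r = 0..n-1) is the paper's B_{r+1} : V_r × {0,1} → V_{r+1}.

record PBP (n w : ℕ) : Set where
  field
    start      : Fin w
    trans      : Fin n → Bool → Fin w → Fin w
    trans-perm : ∀ r b → Bijective _≡_ _≡_ (trans r b)
    acc        : Subset w

open PBP public

module _ {n w : ℕ} (B : PBP n w) where

  -- B[v,x] for v ∈ V_i : read the bits of x starting in layer i.
  -- (Only used with i + |x| ≤ n; past layer n the state is left unchanged.)
  runFrom : ℕ → List Bool → Fin w → Fin w
  runFrom i []       v = v
  runFrom i (b ∷ bs) v with i <? n
  ... | yes p = runFrom (suc i) bs (trans B (fromℕ< p) b v)
  ... | no  _ = v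

  eval : Vec Bool n → Bool
  eval x = lookup (acc B) (runFrom 0 (toList x) (start B))

allInputs : (n : ℕ) → List (Vec Bool n)
allInputs zero    = [] ∷ []
allInputs (suc n) = map (false ∷_) (allInputs n) ++ map (true ∷_) (allInputs n)

Pr : (n : ℕ) → (Vec Bool n → Bool) → ℚ
Pr n f = _/_ (+ length (filter (λ x → T? (f x)) (allInputs n))) (2 ^ n) {{m^n≢0 2 n}}

Hitter : (n : ℕ) → ℚ → List (Vec Bool n) → Set
Hitter n γ H =
  ∀ (w : ℕ) (B : PBP n w) → ∣ acc B ∣ ≡ 1 →
  γ <ℚ Pr n (eval B) → Any (λ x → eval B x ≡ true) H

module HitProgram {n w : ℕ} (B : PBP n w) (H : List (Vec Bool n)) where

  inK : ℕ → Fin w → Bool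
  inK i v = any (λ y → lookup (acc B) (runFrom B i (take (n ∸ i) (toList y)) v)) H

  Ksub : ℕ → Subset w
  Ksub i = tabulate (inK i)

  Kmax : ℕ
  Kmax = foldr _⊔_ 0 (map (λ i → ∣ Ksub i ∣) (upTo (suc n)))

  KElem : ℕ → Set
  KElem i = Σ (Fin w) (λ v → T (inK i v))

  -- K_i' = K_i plus (K - |K_i|) fresh padding states
  Kpad : ℕ → Set
  Kpad i = KElem i ⊎ Fin (Kmax ∸ ∣ Ksub i ∣)

  W : ℕ → Set
  W i = Kpad i ⊎ (Fin (suc n) × Fin Kmax)

  layerIx : ∀ {i} → i < n → Fin (suc n)
  layerIx p = fromℕ< (m<n⇒m<1+n p)

  record IsHitTrans (ι : (i : ℕ) → Kpad i ⤖ Fin Kmax)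
                    (tr : (i : ℕ) → i < n → Bool → W i → W (suc i)) : Set where
    field
      bij   : ∀ i (p : i < n) b → Bijective _≡_ _≡_ (tr i p b)
      stayK : ∀ i (p : i < n) b (v : Fin w) (k : T (inK i v))
                (k' : T (inK (suc i) (trans B (fromℕ< p) b v))) →
              tr i p b (inj₁ (inj₁ (v , k)))
                ≡ inj₁ (inj₁ (trans B (fromℕ< p) b v , k'))
      leaveK : ∀ i (p : i < n) b (v : Fin w) (k : T (inK i v)) →
               ¬ T (inK (suc i) (trans B (fromℕ< p) b v)) →
               tr i p b (inj₁ (inj₁ (v , k)))
                 ≡ inj₂ (layerIx p , Bijection.to (ι i) (inj₁ (v , k)))
      padding : ∀ i (p : i < n) b (q : Fin (Kmax ∸ ∣ Ksub i ∣)) →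
                tr i p b (inj₁ (inj₂ q))
                  ≡ inj₂ (layerIx p , Bijection.to (ι i) (inj₂ q))
      other : ∀ i (p : i < n) b (j : Fin (suc n)) (u : Fin Kmax) →
              toℕ j ≢ i → tr i p b (inj₂ (j , u)) ≡ inj₂ (j , u)

  module _ (tr : (i : ℕ) → i < n → Bool → W i → W (suc i)) where

    runH : W 0 → Vec Bool n → (k : ℕ) → k ≤ n → W k
    runH s x zero    _ = s
    runH s x (suc k) p = tr k p (lookup x (fromℕ< p)) (runH s x k (<⇒≤ p))

    acceptH : W n → Bool
    acceptH (inj₁ (inj₁ (v , _))) = lookup (acc B) v
    acceptH (inj₁ (inj₂ _))       = false
    acceptH (inj₂ _)              = false

    startH : Maybe (W 0)
    startH with T? (inK 0 (start B))
    ... | yes k = just (inj₁ (inj₁ (start B , k)))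
    ... | no  _ = nothing

    evalH : Vec Bool n → Bool
    evalH x = maybe (λ s → acceptH (runH s x n ≤-refl)) false startH

{-# OPTIONS --safe #-}
module Submission where

-- If B accepts x but B_H rejects it, the run of B on x must leave the hit sets: its state at
-- some layer j < n lies outside K_j (B_H only follows B inside the K_i, and every accept
-- vertex lies in K_n as soon as H is non-empty). For v ∉ K_j and an accept vertex t, the
-- single-accept program "start at v in layer j, accept at t" is not hit by H, so it accepts
-- at most a δ/(na) fraction of all inputs. Splitting x into its first j bits and the rest,
-- the inputs escaping at layer j are therefore at most an a · δ/(na) fraction, and summing
-- over the n layers bounds Pr[B] − Pr[B_H] by δ; conversely Pr[B_H] ≤ Pr[B]. All counting is
-- done in ℕ (sums over {0,1}^k); rationals only enter through the hitter and the conclusion.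

module Counting where

  open import Data.Nat using (ℕ; zero; suc; _+_; _*_; _^_; _≤_; z≤n)
  open import Data.Nat.Properties
  open import Data.Nat.ListAction using (sum)
  open import Data.Nat.ListAction.Properties using (sum-++)
  open import Data.Bool using (Bool; true; false; T; T?; not; _∧_)
  open import Data.List as List using (List; length; filter)
  open import Data.List.Properties using (map-++; map-∘)
  open import Data.Vec using (Vec; []; _∷_; _++_; lookup)
  open import Data.Vec.Properties using (lookup-replicate)
  open import Data.Fin using (Fin; zero; suc)
  open import Data.Fin.Subset using (Subset; ⁅_⁆; ∣_∣)
  import Data.Integer as ℤ
  open import Data.Rational using (_/_)
  open import Function using (_∘_)
  open import Relation.Nullary using (¬_)
  open import Relation.Binary.PropositionalEquality
  open import Algebra.Properties.Semiring.Sum +-*-semiring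
    using (sum-syntax; ∑-distrib-+; sum-remove; sum-cong-≗; sum-replicate-zero)
  import Algebra.Properties.CommutativeSemigroup +-commutativeSemigroup as +-Comm
  open import Defs using (allInputs; Pr)

  𝟙 : Bool → ℕ
  𝟙 true  = 1
  𝟙 false = 0

  𝟙-∧ : ∀ b c → 𝟙 (b ∧ c) ≡ 𝟙 b * 𝟙 c
  𝟙-∧ true  c = sym (*-identityˡ (𝟙 c))
  𝟙-∧ false c = refl

  𝟙-≤ : ∀ {b c} → (T b → 1 ≤ c) → 𝟙 b ≤ c
  𝟙-≤ {true}  h = h _
  𝟙-≤ {false} h = z≤n

  T⇒𝟙≡1 : ∀ {b} → T b → 𝟙 b ≡ 1
  T⇒𝟙≡1 {true} _ = refl

  ¬T⇒T-not : ∀ {b} → ¬ T b → T (not b)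
  ¬T⇒T-not {true}  ¬b = ¬b _
  ¬T⇒T-not {false} _  = _

  ∑ᴮ : (k : ℕ) → (Vec Bool k → ℕ) → ℕ
  ∑ᴮ zero    f = f []
  ∑ᴮ (suc k) f = ∑ᴮ k (f ∘ (false ∷_)) + ∑ᴮ k (f ∘ (true ∷_))

  ∑ᴮ-cong : ∀ k {f g : Vec Bool k → ℕ} → (∀ x → f x ≡ g x) → ∑ᴮ k f ≡ ∑ᴮ k g
  ∑ᴮ-cong zero    f≗g = f≗g []
  ∑ᴮ-cong (suc k) f≗g = cong₂ _+_ (∑ᴮ-cong k (f≗g ∘ (false ∷_))) (∑ᴮ-cong k (f≗g ∘ (true ∷_)))

  ∑ᴮ-mono : ∀ k {f g : Vec Bool k → ℕ} → (∀ x → f x ≤ g x) → ∑ᴮ k f ≤ ∑ᴮ k g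
  ∑ᴮ-mono zero    f≤g = f≤g []
  ∑ᴮ-mono (suc k) f≤g = +-mono-≤ (∑ᴮ-mono k (f≤g ∘ (false ∷_))) (∑ᴮ-mono k (f≤g ∘ (true ∷_)))

  ∑ᴮ-const : ∀ k c → ∑ᴮ k (λ _ → c) ≡ 2 ^ k * c
  ∑ᴮ-const zero    c = sym (*-identityˡ c)
  ∑ᴮ-const (suc k) c = begin
    ∑ᴮ k (λ _ → c) + ∑ᴮ k (λ _ → c) ≡⟨ cong₂ _+_ (∑ᴮ-const k c) (∑ᴮ-const k c) ⟩
    2 ^ k * c + 2 ^ k * c           ≡⟨ cong (2 ^ k * c +_) (+-identityʳ (2 ^ k * c)) ⟨
    2 * (2 ^ k * c)                 ≡⟨ *-assoc 2 (2 ^ k) c ⟨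
    2 ^ suc k * c                   ∎
    where open ≡-Reasoning

  ∑ᴮ-≤ : ∀ k {f : Vec Bool k → ℕ} {c} → (∀ x → f x ≤ c) → ∑ᴮ k f ≤ 2 ^ k * c
  ∑ᴮ-≤ k {c = c} f≤c = ≤-trans (∑ᴮ-mono k f≤c) (≤-reflexive (∑ᴮ-const k c))

  ∑ᴮ-distrib-+ : ∀ k (f g : Vec Bool k → ℕ) → ∑ᴮ k (λ x → f x + g x) ≡ ∑ᴮ k f + ∑ᴮ k g
  ∑ᴮ-distrib-+ zero    f g = refl
  ∑ᴮ-distrib-+ (suc k) f g = trans
    (cong₂ _+_ (∑ᴮ-distrib-+ k (f ∘ (false ∷_)) (g ∘ (false ∷_)))
               (∑ᴮ-distrib-+ k (f ∘ (true ∷_)) (g ∘ (true ∷_))))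
    (+-Comm.interchange (∑ᴮ k (f ∘ (false ∷_))) (∑ᴮ k (g ∘ (false ∷_)))
                        (∑ᴮ k (f ∘ (true ∷_))) (∑ᴮ k (g ∘ (true ∷_))))

  *-distribˡ-∑ᴮ : ∀ k c (f : Vec Bool k → ℕ) → c * ∑ᴮ k f ≡ ∑ᴮ k (λ x → c * f x)
  *-distribˡ-∑ᴮ zero    c f = refl
  *-distribˡ-∑ᴮ (suc k) c f = trans (*-distribˡ-+ c _ _)
    (cong₂ _+_ (*-distribˡ-∑ᴮ k c (f ∘ (false ∷_))) (*-distribˡ-∑ᴮ k c (f ∘ (true ∷_))))

  ∑ᴮ-++ : ∀ j k (f : Vec Bool (j + k) → ℕ) →
          ∑ᴮ (j + k) f ≡ ∑ᴮ j (λ p → ∑ᴮ k (λ z → f (p ++ z)))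
  ∑ᴮ-++ zero    k f = refl
  ∑ᴮ-++ (suc j) k f = cong₂ _+_ (∑ᴮ-++ j k (f ∘ (false ∷_))) (∑ᴮ-++ j k (f ∘ (true ∷_)))

  ∑ᴮ-∑ : ∀ k {m} (f : Fin m → Vec Bool k → ℕ) →
         ∑ᴮ k (λ x → ∑[ i < m ] f i x) ≡ ∑[ i < m ] ∑ᴮ k (f i)
  ∑ᴮ-∑ zero    f = refl
  ∑ᴮ-∑ (suc k) f = trans
    (cong₂ _+_ (∑ᴮ-∑ k (λ i → f i ∘ (false ∷_))) (∑ᴮ-∑ k (λ i → f i ∘ (true ∷_))))
    (sym (∑-distrib-+ (λ i → ∑ᴮ k (f i ∘ (false ∷_))) (λ i → ∑ᴮ k (f i ∘ (true ∷_)))))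

  length-filter≡sum-𝟙 : ∀ {A : Set} (f : A → Bool) xs →
    length (filter (λ x → T? (f x)) xs) ≡ sum (List.map (𝟙 ∘ f) xs)
  length-filter≡sum-𝟙 f List.[]       = refl
  length-filter≡sum-𝟙 f (x List.∷ xs) with f x
  ... | true  = cong suc (length-filter≡sum-𝟙 f xs)
  ... | false = length-filter≡sum-𝟙 f xs

  sum-map-allInputs : ∀ n (g : Vec Bool n → ℕ) → sum (List.map g (allInputs n)) ≡ ∑ᴮ n g
  sum-map-allInputs zero    g = +-identityʳ (g [])
  sum-map-allInputs (suc n) g = begin
    sum (List.map g (List.map (false ∷_) xs List.++ List.map (true ∷_) xs))
      ≡⟨ cong sum (map-++ g (List.map (false ∷_) xs) _) ⟩
    sum (List.map g (List.map (false ∷_) xs) List.++ List.map g (List.map (true ∷_) xs))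
      ≡⟨ sum-++ (List.map g (List.map (false ∷_) xs)) _ ⟩
    sum (List.map g (List.map (false ∷_) xs)) + sum (List.map g (List.map (true ∷_) xs))
      ≡⟨ cong₂ (λ l r → sum l + sum r) (map-∘ xs) (map-∘ xs) ⟨
    sum (List.map (g ∘ (false ∷_)) xs) + sum (List.map (g ∘ (true ∷_)) xs)
      ≡⟨ cong₂ _+_ (sum-map-allInputs n (g ∘ (false ∷_))) (sum-map-allInputs n (g ∘ (true ∷_))) ⟩
    ∑ᴮ (suc n) g
      ∎
    where
    open ≡-Reasoning
    xs = allInputs n

  Pr≡∑ᴮ/2^n : ∀ n (f : Vec Bool n → Bool) → Pr n f ≡ _/_ (ℤ.+ ∑ᴮ n (𝟙 ∘ f)) (2 ^ n) {{m^n≢0 2 n}}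
  Pr≡∑ᴮ/2^n n f = cong (λ c → _/_ (ℤ.+ c) (2 ^ n) {{m^n≢0 2 n}})
    (trans (length-filter≡sum-𝟙 f (allInputs n)) (sum-map-allInputs n (𝟙 ∘ f)))

  ∑-≤ : ∀ m {f : Fin m → ℕ} {c} → (∀ i → f i ≤ c) → ∑[ i < m ] f i ≤ m * c
  ∑-≤ zero    f≤c = z≤n
  ∑-≤ (suc m) f≤c = +-mono-≤ (f≤c zero) (∑-≤ m (f≤c ∘ suc))

  ≤-∑ : ∀ {m} (f : Fin m → ℕ) i → f i ≤ ∑[ j < m ] f j
  ≤-∑ {suc m} f i = ≤-trans (m≤m+n (f i) _) (≤-reflexive (sym (sum-remove {i = i} f)))

  ∑-sift : ∀ {w} (f : Fin w → ℕ) u → ∑[ t < w ] (f t * 𝟙 (lookup ⁅ t ⁆ u)) ≡ f u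
  ∑-sift {suc w} f zero = begin
    f zero * 1 + ∑[ t < w ] (f (suc t) * 0)
      ≡⟨ cong₂ _+_ (*-identityʳ (f zero)) (sum-cong-≗ (*-zeroʳ ∘ f ∘ suc)) ⟩
    f zero + ∑[ t < w ] 0 ≡⟨ cong (f zero +_) (sum-replicate-zero w) ⟩
    f zero + 0            ≡⟨ +-identityʳ (f zero) ⟩
    f zero                ∎
    where open ≡-Reasoning
  ∑-sift {suc w} f (suc u) = begin
    f zero * 𝟙 (lookup ⁅ zero ⁆ (suc u)) + ∑[ t < w ] (f (suc t) * 𝟙 (lookup ⁅ t ⁆ u))
      ≡⟨ cong₂ _+_ (cong (λ b → f zero * 𝟙 b) (lookup-replicate u false)) (∑-sift (f ∘ suc) u) ⟩
    f zero * 0 + f (suc u) ≡⟨ cong (_+ f (suc u)) (*-zeroʳ (f zero)) ⟩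
    f (suc u)              ∎
    where open ≡-Reasoning

  ∑-𝟙-weighted-≤ : ∀ {w} (S : Subset w) {f : Fin w → ℕ} {c} →
                   (∀ t → T (lookup S t) → f t ≤ c) → ∑[ t < w ] (𝟙 (lookup S t) * f t) ≤ ∣ S ∣ * c
  ∑-𝟙-weighted-≤ []          f≤c = z≤n
  ∑-𝟙-weighted-≤ (true ∷ S)  {f} f≤c =
    +-mono-≤ (≤-trans (≤-reflexive (*-identityˡ (f zero))) (f≤c zero _)) (∑-𝟙-weighted-≤ S (f≤c ∘ suc))
  ∑-𝟙-weighted-≤ (false ∷ S) f≤c = ∑-𝟙-weighted-≤ S (f≤c ∘ suc)

module Fractions where

  open import Data.Nat as ℕ using (ℕ; suc; _*_; _∸_; _≤_; NonZero)
  import Data.Nat.Properties as ℕ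
  open import Data.Integer as ℤ using (+_; -[1+_]; +≤+)
  import Data.Integer.Properties as ℤ
  open import Data.Rational as ℚ using (ℚ; mkℚ; 0ℚ; ↥_; ↧ₙ_; toℚᵘ; _/_)
  open import Data.Rational.Properties as ℚ using (toℚᵘ-fromℚᵘ; toℚᵘ-mono-≤; toℚᵘ-cancel-≤)
  open import Data.Rational.Unnormalised as ℚᵘ using (mkℚᵘ; *≤*)
  import Data.Rational.Unnormalised.Properties as ℚᵘ
  open import Relation.Binary.PropositionalEquality
  import Algebra.Properties.CommutativeSemigroup ℕ.*-commutativeSemigroup as *-Comm

  ↥≡+∣↥∣ : ∀ {δ} → 0ℚ ℚ.< δ → ↥ δ ≡ + ℤ.∣ ↥ δ ∣
  ↥≡+∣↥∣ {mkℚ (+ _)     _ _} _          = refl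
  ↥≡+∣↥∣ {mkℚ -[1+ _ ] _ _} (ℚ.*<* ())

  -- ℚ._/_ normalises, so c / m is compared through ℚᵘ, where it keeps numerator c and
  -- denominator m and the order is plain cross-multiplication.
  toℚᵘ-/ : ∀ c m → toℚᵘ (+ c / suc m) ℚᵘ.≃ mkℚᵘ (+ c) m
  toℚᵘ-/ c m = toℚᵘ-fromℚᵘ (mkℚᵘ (+ c) m)

  +*+≤+*+⇒*≤* : ∀ a b c d → + a ℤ.* + b ℤ.≤ + c ℤ.* + d → a * b ≤ c * d
  +*+≤+*+⇒*≤* a b c d le rewrite sym (ℤ.pos-* a b) | sym (ℤ.pos-* c d) = ℤ.drop‿+≤+ le

  /≤δ*1/k⇒ : ∀ c m k .{{_ : NonZero m}} .{{_ : NonZero k}} δ {p} → ↥ δ ≡ + p →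
             + c / m ℚ.≤ δ ℚ.* (+ 1 / k) → c * (↧ₙ δ * k) ≤ p * m
  /≤δ*1/k⇒ c (suc m) (suc k) δ@(mkℚ _ _ _) {p} refl le
    with ℚᵘ.≤-respˡ-≃ (toℚᵘ-/ c m)
           (ℚᵘ.≤-respʳ-≃ (ℚᵘ.≃-trans (ℚ.toℚᵘ-homo-* δ (+ 1 / suc k))
                                      (ℚᵘ.*-congˡ {toℚᵘ δ} (toℚᵘ-/ 1 k)))
             (toℚᵘ-mono-≤ le))
  ... | *≤* le′ rewrite ℤ.*-identityʳ (+ p) = +*+≤+*+⇒*≤* c _ p (suc m) le′

  ∣+h*m-+b*m∣≡[b∸h]*m : ∀ h b m → h ≤ b →
    ℤ.∣ + h ℤ.* + m ℤ.+ ℤ.- (+ b) ℤ.* + m ∣ ≡ (b ∸ h) * m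
  ∣+h*m-+b*m∣≡[b∸h]*m h b m h≤b = begin
    ℤ.∣ + h ℤ.* + m ℤ.+ ℤ.- (+ b) ℤ.* + m ∣
      ≡⟨ cong ℤ.∣_∣ (cong₂ ℤ._+_ (sym (ℤ.pos-* h m))
           (trans (sym (ℤ.neg-distribˡ-* (+ b) (+ m))) (cong ℤ.-_ (sym (ℤ.pos-* b m))))) ⟩
    ℤ.∣ + (h * m) ℤ.+ ℤ.- + (b * m) ∣ ≡⟨ cong ℤ.∣_∣ (ℤ.m-n≡m⊖n (h * m) (b * m)) ⟩
    ℤ.∣ (h * m) ℤ.⊖ (b * m) ∣         ≡⟨ ℤ.∣m⊖n∣≡∣n⊖m∣ (h * m) (b * m) ⟩
    ℤ.∣ (b * m) ℤ.⊖ (h * m) ∣         ≡⟨ cong ℤ.∣_∣ (ℤ.⊖-≥ (ℕ.*-monoˡ-≤ m h≤b)) ⟩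
    b * m ∸ h * m                     ≡⟨ ℕ.*-distribʳ-∸ m b h ⟨
    (b ∸ h) * m                       ∎
    where open ≡-Reasoning

  ∣/-/∣≤δ : ∀ h b m .{{_ : NonZero m}} δ {p} → ↥ δ ≡ + p → h ≤ b →
            (b ∸ h) * ↧ₙ δ ≤ p * m → ℚ.∣ + h / m ℚ.- + b / m ∣ ℚ.≤ δ
  ∣/-/∣≤δ h b m@(suc m-1) δ@(mkℚ _ d _) {p} refl h≤b le =
    toℚᵘ-cancel-≤ (ℚᵘ.≤-respˡ-≃ (ℚᵘ.≃-sym toℚᵘ-dist) (*≤* cross))
    where
    toℚᵘ-dist : toℚᵘ (ℚ.∣ + h / m ℚ.- + b / m ∣)
                ℚᵘ.≃ ℚᵘ.∣ mkℚᵘ (+ h) m-1 ℚᵘ.- mkℚᵘ (+ b) m-1 ∣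
    toℚᵘ-dist = ℚᵘ.≃-trans (ℚ.toℚᵘ-homo-∣-∣ _) (ℚᵘ.∣-∣-cong
      (ℚᵘ.≃-trans (ℚ.toℚᵘ-homo-+ (+ h / m) (ℚ.- (+ b / m)))
        (ℚᵘ.+-cong (toℚᵘ-/ h m-1)
                   (ℚᵘ.≃-trans (ℚ.toℚᵘ-homo‿- (+ b / m)) (ℚᵘ.-‿cong (toℚᵘ-/ b m-1))))))
    cross : + ℤ.∣ + h ℤ.* + m ℤ.+ ℤ.- (+ b) ℤ.* + m ∣ ℤ.* + suc d ℤ.≤ + p ℤ.* + (m * m)
    cross rewrite ∣+h*m-+b*m∣≡[b∸h]*m h b m h≤b
                | sym (ℤ.pos-* ((b ∸ h) * m) (suc d)) | sym (ℤ.pos-* p (m * m)) = +≤+ (begin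
      (b ∸ h) * m * suc d ≡⟨ *-Comm.xy∙z≈xz∙y (b ∸ h) m (suc d) ⟩
      (b ∸ h) * suc d * m ≤⟨ ℕ.*-monoˡ-≤ m le ⟩
      p * m * m           ≡⟨ ℕ.*-assoc p m m ⟩
      p * (m * m)         ∎)
      where open ℕ.≤-Reasoning
module BranchingPrograms where

  open import Data.Nat using (ℕ; zero; suc; _+_; _*_; _∸_; _^_; _≤_; _<_; _<?_; _⊓_; s<s⁻¹)
  open import Data.Nat.Properties
  open import Data.Bool using (Bool)
  open import Data.List using (List; []; _∷_; _++_; length; take)
  open import Data.List.Properties using (take-[]; take-all; length-take)
  open import Data.Fin using (Fin; toℕ; fromℕ<)
  open import Data.Fin.Properties using (toℕ-fromℕ<)
  open import Data.Fin.Subset using (Subset; ⁅_⁆)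
  open import Data.Vec as Vec using (Vec; lookup; toList)
  open import Data.Vec.Properties using (toList-++; length-toList)
  open import Data.Sum using (inj₁; inj₂)
  open import Function using (_∘_; id)
  open import Function.Definitions using (Bijective)
  import Function.Construct.Identity as Identity
  open import Relation.Nullary using (¬_; yes; no; contradiction)
  open import Relation.Binary.PropositionalEquality as ≡ hiding (trans)
  open import Algebra.Properties.Semiring.Sum +-*-semiring using (sum-syntax; sum-cong-≗)
  open import Defs
  open Counting

  2^n≡2^j*2^[n∸j] : ∀ {j n} → j ≤ n → 2 ^ n ≡ 2 ^ j * 2 ^ (n ∸ j)
  2^n≡2^j*2^[n∸j] {j} {n} j≤n =
    ≡.trans (cong (2 ^_) (sym (m+[n∸m]≡n j≤n))) (^-distribˡ-+-* 2 j (n ∸ j))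

  take-suc-toList : ∀ {A : Set} {n k} (x : Vec A n) (k<n : k < n) →
                    take (suc k) (toList x) ≡ take k (toList x) ++ lookup x (fromℕ< k<n) ∷ []
  take-suc-toList {k = zero}  (a Vec.∷ x) _   = refl
  take-suc-toList {k = suc k} (a Vec.∷ x) k<n = cong (a ∷_) (take-suc-toList x (s<s⁻¹ k<n))

  take-toList-++ : ∀ {A : Set} {j k} (p : Vec A j) (z : Vec A k) →
                   take j (toList (p Vec.++ z)) ≡ toList p
  take-toList-++ Vec.[]      z = refl
  take-toList-++ (a Vec.∷ p) z = cong (a ∷_) (take-toList-++ p z)

  module _ {n w : ℕ} (B : PBP n w) where

    -- The identity beyond layer n makes runFrom unfold uniformly at every layer (runFrom-∷).
    transAt : ℕ → Bool → Fin w → Fin w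
    transAt i b with i <? n
    ... | yes i<n = trans B (fromℕ< i<n) b
    ... | no  _   = id

    transAt-bijective : ∀ i b → Bijective _≡_ _≡_ (transAt i b)
    transAt-bijective i b with i <? n
    ... | yes i<n = trans-perm B (fromℕ< i<n) b
    ... | no  _   = Identity.bijective _≡_

    transAt-< : ∀ {i} (i<n : i < n) b v → transAt i b v ≡ trans B (fromℕ< i<n) b v
    transAt-< {i} i<n b v with i <? n
    ... | yes _   = refl
    ... | no  i≮n = contradiction i<n i≮n

    transAt-≮ : ∀ {i} → ¬ i < n → ∀ b v → transAt i b v ≡ v
    transAt-≮ {i} i≮n b v with i <? n
    ... | yes i<n = contradiction i<n i≮n
    ... | no  _   = refl

    runFrom-≮ : ∀ {i} → ¬ i < n → ∀ l v → runFrom B i l v ≡ v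
    runFrom-≮ {i} i≮n []      v = refl
    runFrom-≮ {i} i≮n (b ∷ l) v with i <? n
    ... | yes i<n = contradiction i<n i≮n
    ... | no  _   = refl

    runFrom-∷ : ∀ i b l v → runFrom B i (b ∷ l) v ≡ runFrom B (suc i) l (transAt i b v)
    runFrom-∷ i b l v with i <? n
    ... | yes _   = refl
    ... | no  i≮n = sym (runFrom-≮ (i≮n ∘ <-trans (n<1+n i)) l v)

    runFrom-++ : ∀ i xs ys v →
                 runFrom B i (xs ++ ys) v ≡ runFrom B (i + length xs) ys (runFrom B i xs v)
    runFrom-++ i []       ys v = cong (λ k → runFrom B k ys v) (sym (+-identityʳ i))
    runFrom-++ i (b ∷ xs) ys v = begin
      runFrom B i (b ∷ xs ++ ys) v
        ≡⟨ runFrom-∷ i b (xs ++ ys) v ⟩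
      runFrom B (suc i) (xs ++ ys) (transAt i b v)
        ≡⟨ runFrom-++ (suc i) xs ys (transAt i b v) ⟩
      runFrom B (suc i + length xs) ys (runFrom B (suc i) xs (transAt i b v))
        ≡⟨ cong₂ (λ k u → runFrom B k ys u) (sym (+-suc i (length xs))) (sym (runFrom-∷ i b xs v)) ⟩
      runFrom B (i + suc (length xs)) ys (runFrom B i (b ∷ xs) v)
        ∎
      where open ≡-Reasoning

    runFrom-++-≮ : ∀ {i} xs ys v → ¬ i + length xs < n → runFrom B i (xs ++ ys) v ≡ runFrom B i xs v
    runFrom-++-≮ {i} xs ys v ≮n = ≡.trans (runFrom-++ i xs ys v) (runFrom-≮ ≮n ys _)

    runFrom-take : ∀ i l v → runFrom B i l v ≡ runFrom B i (take (n ∸ i) l) v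
    runFrom-take i []      v = cong (λ l → runFrom B i l v) (sym (take-[] (n ∸ i)))
    runFrom-take i (b ∷ l) v with ≤-<-connex n i
    ... | inj₁ n≤i = ≡.trans (runFrom-≮ (≤⇒≯ n≤i) (b ∷ l) v)
                             (sym (runFrom-≮ (≤⇒≯ n≤i) (take (n ∸ i) (b ∷ l)) v))
    ... | inj₂ i<n = begin
      runFrom B i (b ∷ l) v                                  ≡⟨ runFrom-∷ i b l v ⟩
      runFrom B (suc i) l (transAt i b v)                    ≡⟨ runFrom-take (suc i) l _ ⟩
      runFrom B (suc i) (take (n ∸ suc i) l) (transAt i b v) ≡⟨ runFrom-∷ i b _ v ⟨
      runFrom B i (take (suc (n ∸ suc i)) (b ∷ l)) v
        ≡⟨ cong (λ k → runFrom B i (take k (b ∷ l)) v) (+-∸-assoc 1 i<n) ⟨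
      runFrom B i (take (n ∸ i) (b ∷ l)) v                   ∎
      where open ≡-Reasoning

    -- Reads the first n ∸ j input bits through layers j, …, n − 1 (exactly the runs that
    -- inK j v inspects) and ignores the rest.
    suffixProgram : ℕ → Fin w → Subset w → PBP n w
    suffixProgram j v S = record
      { start      = v
      ; trans      = λ r → transAt (toℕ r + j)
      ; trans-perm = λ r → transAt-bijective (toℕ r + j)
      ; acc        = S
      }

    run : List Bool → Fin w
    run l = runFrom B 0 l (start B)

    runFrom-toList-++ : ∀ {j k} (p : Vec Bool j) (z : Vec Bool k) v →
      runFrom B 0 (toList (p Vec.++ z)) v ≡ runFrom B j (toList z) (runFrom B 0 (toList p) v)
    runFrom-toList-++ {j} p z v = begin
      runFrom B 0 (toList (p Vec.++ z)) v
        ≡⟨ cong (λ l → runFrom B 0 l v) (toList-++ p z) ⟩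
      runFrom B 0 (toList p ++ toList z) v
        ≡⟨ runFrom-++ 0 (toList p) (toList z) v ⟩
      runFrom B (length (toList p)) (toList z) (runFrom B 0 (toList p) v)
        ≡⟨ cong (λ k → runFrom B k (toList z) (runFrom B 0 (toList p) v)) (length-toList p) ⟩
      runFrom B j (toList z) (runFrom B 0 (toList p) v)
        ∎
      where open ≡-Reasoning

    run-take-suc : ∀ (x : Vec Bool n) {k} (k<n : k < n) →
      run (take (suc k) (toList x)) ≡ trans B (fromℕ< k<n) (lookup x (fromℕ< k<n)) (run (take k (toList x)))
    run-take-suc x {k} k<n = begin
      run (take (suc k) (toList x))                     ≡⟨ cong run (take-suc-toList x k<n) ⟩
      run (take k (toList x) ++ b ∷ [])                 ≡⟨ runFrom-++ 0 (take k (toList x)) (b ∷ []) (start B) ⟩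
      runFrom B (length (take k (toList x))) (b ∷ []) u ≡⟨ cong (λ i → runFrom B i (b ∷ []) u) length-prefix ⟩
      runFrom B k (b ∷ []) u                            ≡⟨ runFrom-∷ k b [] u ⟩
      transAt k b u                                     ≡⟨ transAt-< k<n b u ⟩
      trans B (fromℕ< k<n) b u                          ∎
      where
      open ≡-Reasoning
      b = lookup x (fromℕ< k<n)
      u = run (take k (toList x))
      length-prefix : length (take k (toList x)) ≡ k
      length-prefix = ≡.trans (length-take k (toList x))
                              (≡.trans (cong (k ⊓_) (length-toList x)) (m≤n⇒m⊓n≡m (<⇒≤ k<n)))

    run-take-n : ∀ (x : Vec Bool n) → run (take n (toList x)) ≡ run (toList x)
    run-take-n x = cong run (take-all n (toList x) (≤-reflexive (length-toList x)))

  module _ {n w : ℕ} (B : PBP n w) where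

    transAt-suffixProgram : ∀ j v S i b u → transAt (suffixProgram B j v S) i b u ≡ transAt B (i + j) b u
    transAt-suffixProgram j v S i b u with i <? n
    ... | yes i<n = cong (λ k → transAt B (k + j) b u) (toℕ-fromℕ< i<n)
    ... | no  i≮n = sym (transAt-≮ B (i≮n ∘ ≤-<-trans (m≤m+n i j)) b u)

    runFrom-suffixProgram : ∀ j v S i l u → runFrom (suffixProgram B j v S) i l u ≡ runFrom B (i + j) l u
    runFrom-suffixProgram j v S i []      u = refl
    runFrom-suffixProgram j v S i (b ∷ l) u = begin
      runFrom B′ i (b ∷ l) u                            ≡⟨ runFrom-∷ B′ i b l u ⟩
      runFrom B′ (suc i) l (transAt B′ i b u)           ≡⟨ runFrom-suffixProgram j v S (suc i) l _ ⟩
      runFrom B (suc (i + j)) l (transAt B′ i b u)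
        ≡⟨ cong (runFrom B (suc (i + j)) l) (transAt-suffixProgram j v S i b u) ⟩
      runFrom B (suc (i + j)) l (transAt B (i + j) b u) ≡⟨ runFrom-∷ B (i + j) b l u ⟨
      runFrom B (i + j) (b ∷ l) u                       ∎
      where
      open ≡-Reasoning
      B′ = suffixProgram B j v S

    eval-suffixProgram : ∀ j v S y → eval (suffixProgram B j v S) y ≡ lookup S (runFrom B j (toList y) v)
    eval-suffixProgram j v S y = cong (lookup S) (runFrom-suffixProgram j v S 0 (toList y) v)

    reachCount : ℕ → Fin w → Subset w → ℕ
    reachCount j v S = ∑ᴮ (n ∸ j) (λ z → 𝟙 (lookup S (runFrom B j (toList z) v)))

    count-suffixProgram : ∀ {j} → j ≤ n → ∀ v S →
      ∑ᴮ n (𝟙 ∘ eval (suffixProgram B j v S)) ≡ 2 ^ j * reachCount j v S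
    count-suffixProgram {j} j≤n v S = begin
      ∑ᴮ n (𝟙 ∘ eval (suffixProgram B j v S))
        ≡⟨ ∑ᴮ-cong n (cong 𝟙 ∘ eval-suffixProgram j v S) ⟩
      ∑ᴮ n (g ∘ toList)
        ≡⟨ cong (λ k → ∑ᴮ k (g ∘ toList)) (m∸n+n≡m j≤n) ⟨
      ∑ᴮ (n ∸ j + j) (g ∘ toList)
        ≡⟨ ∑ᴮ-++ (n ∸ j) j (g ∘ toList) ⟩
      ∑ᴮ (n ∸ j) (λ p → ∑ᴮ j (λ z → g (toList (p Vec.++ z))))
        ≡⟨ ∑ᴮ-cong (n ∸ j) (λ p → ∑ᴮ-cong j (λ z → cong 𝟙 (ignores-tail p z))) ⟩
      ∑ᴮ (n ∸ j) (λ p → ∑ᴮ j (λ _ → g (toList p)))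
        ≡⟨ ∑ᴮ-cong (n ∸ j) (λ p → ∑ᴮ-const j (g (toList p))) ⟩
      ∑ᴮ (n ∸ j) (λ p → 2 ^ j * g (toList p))
        ≡⟨ *-distribˡ-∑ᴮ (n ∸ j) (2 ^ j) (g ∘ toList) ⟨
      2 ^ j * reachCount j v S
        ∎
      where
      open ≡-Reasoning
      g : List Bool → ℕ
      g l = 𝟙 (lookup S (runFrom B j l v))
      ignores-tail : ∀ (p : Vec Bool (n ∸ j)) (z : Vec Bool j) →
                     lookup S (runFrom B j (toList (p Vec.++ z)) v) ≡ lookup S (runFrom B j (toList p) v)
      ignores-tail p z = cong (lookup S) (≡.trans (cong (λ l → runFrom B j l v) (toList-++ p z))
        (runFrom-++-≮ B (toList p) (toList z) v (≤⇒≯ (≤-reflexive reaches-n))))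
        where
        reaches-n : n ≡ j + length (toList p)
        reaches-n = sym (≡.trans (cong (j +_) (length-toList p)) (m+[n∸m]≡n j≤n))

    reachCount-decompose : ∀ j v S →
      reachCount j v S ≡ ∑[ t < w ] (𝟙 (lookup S t) * reachCount j v ⁅ t ⁆)
    reachCount-decompose j v S = begin
      ∑ᴮ (n ∸ j) (λ z → 𝟙 (lookup S (end z)))
        ≡⟨ ∑ᴮ-cong (n ∸ j) (λ z → ∑-sift (𝟙 ∘ lookup S) (end z)) ⟨
      ∑ᴮ (n ∸ j) (λ z → ∑[ t < w ] (𝟙 (lookup S t) * 𝟙 (lookup ⁅ t ⁆ (end z))))
        ≡⟨ ∑ᴮ-∑ (n ∸ j) (λ t z → 𝟙 (lookup S t) * 𝟙 (lookup ⁅ t ⁆ (end z))) ⟩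
      ∑[ t < w ] ∑ᴮ (n ∸ j) (λ z → 𝟙 (lookup S t) * 𝟙 (lookup ⁅ t ⁆ (end z)))
        ≡⟨ sum-cong-≗ (λ t → *-distribˡ-∑ᴮ (n ∸ j) (𝟙 (lookup S t)) _) ⟨
      ∑[ t < w ] (𝟙 (lookup S t) * reachCount j v ⁅ t ⁆)
        ∎
      where
      open ≡-Reasoning
      end : Vec Bool (n ∸ j) → Fin w
      end z = runFrom B j (toList z) v

module HitPrograms where

  open import Data.Nat using (ℕ; zero; suc; _+_; _*_; _∸_; _^_; _≤_; _<_; z≤n; NonZero; >-nonZero⁻¹)
  open import Data.Nat.Properties
  open import Data.Bool using (Bool; true; false; T; T?; not; _∧_)
  open import Data.Bool.Properties using (T-∧)
  open import Data.List using (List; take)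
  import Data.List.Relation.Unary.Any as Any
  open import Data.List.Relation.Unary.Any.Properties using (any⁺; any⁻)
  open import Data.Fin using (Fin; toℕ; fromℕ<)
  open import Data.Fin.Properties using (toℕ-fromℕ<; toℕ<n)
  open import Data.Fin.Subset using (⁅_⁆; ∣_∣)
  open import Data.Fin.Subset.Properties using (∣⁅x⁆∣≡1; x∈⁅y⁆⇒x≡y)
  open import Data.Vec as Vec using (Vec; lookup; toList)
  open import Data.Vec.Properties using (lookup⇒[]=)
  open import Data.Integer using (+_)
  open import Data.Rational as ℚ using (ℚ; ↥_; ↧ₙ_; _/_)
  import Data.Rational.Properties as ℚ
  open import Data.Product using (Σ-syntax; _×_; _,_)
  open import Data.Sum using (_⊎_; inj₁; inj₂)
  open import Function using (_∘_)
  open import Function.Bundles using (_⤖_; Equivalence)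
  open import Relation.Nullary using (¬_; yes; no; contradiction)
  open import Relation.Binary.PropositionalEquality as ≡ hiding (trans)
  open import Algebra.Properties.Semiring.Sum +-*-semiring
    using (sum-syntax; sum-cong-≗; *-distribˡ-sum; *-distribʳ-sum)
  import Algebra.Properties.CommutativeSemigroup *-commutativeSemigroup as *-Comm
  open import Defs
  open Counting
  open Fractions
  open BranchingPrograms

  module _ {n w : ℕ} (B : PBP n w) (H : List (Vec Bool n)) where
    open HitProgram B H

    escapesAt : ℕ → List Bool → Bool
    escapesAt j l = not (inK j (run B (take j l))) ∧ lookup (acc B) (run B l)

    escapeCount : ℕ → ℕ
    escapeCount j = ∑ᴮ n (λ x → 𝟙 (escapesAt j (toList x)))

    acc⊆Kₙ : ∀ {i v u} → T (inK i v) → T (lookup (acc B) u) → T (inK n u)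
    acc⊆Kₙ {i} {v} {u} v∈K u∈acc = any⁺ _ (Any.map (λ {y} _ → stays-at-u y) (any⁻ _ H v∈K))
      where
      stays-at-u : ∀ y → T (lookup (acc B) (runFrom B n (take (n ∸ n) (toList y)) u))
      stays-at-u y =
        subst (T ∘ lookup (acc B)) (sym (runFrom-≮ B (<-irrefl refl) (take (n ∸ n) (toList y)) u)) u∈acc

    Pr-suffixProgram≤ : ∀ {γ} → Hitter n γ H → ∀ {j v t} → ¬ T (inK j v) → T (lookup (acc B) t) →
                        Pr n (eval (suffixProgram B j v ⁅ t ⁆)) ℚ.≤ γ
    Pr-suffixProgram≤ hit {j} {v} {t} v∉K t∈acc = ℚ.≮⇒≥ λ γ<Pr →
      v∉K (any⁺ _ (Any.map reaches-acc (hit w (suffixProgram B j v ⁅ t ⁆) (∣⁅x⁆∣≡1 t) γ<Pr)))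
      where
      reaches-acc : ∀ {y} → eval (suffixProgram B j v ⁅ t ⁆) y ≡ true →
                    T (lookup (acc B) (runFrom B j (take (n ∸ j) (toList y)) v))
      reaches-acc {y} accepted =
        subst (T ∘ lookup (acc B)) (≡.trans (sym ends-at-t) (runFrom-take B j (toList y) v)) t∈acc
        where
        ends-at-t : runFrom B j (toList y) v ≡ t
        ends-at-t = x∈⁅y⁆⇒x≡y t (lookup⇒[]= _ ⁅ t ⁆
          (≡.trans (sym (eval-suffixProgram B j v ⁅ t ⁆ y)) accepted))

    escapeWeight : ℕ → Fin w → ℕ
    escapeWeight j v = 𝟙 (not (inK j v)) * reachCount B j v (acc B)

    escapeCount-split : ∀ {j} → j ≤ n → escapeCount j ≡ ∑ᴮ j (escapeWeight j ∘ run B ∘ toList)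
    escapeCount-split {j} j≤n = begin
      escapeCount j                 ≡⟨ cong (λ k → ∑ᴮ k (e ∘ toList)) (m+[n∸m]≡n j≤n) ⟨
      ∑ᴮ (j + (n ∸ j)) (e ∘ toList) ≡⟨ ∑ᴮ-++ j (n ∸ j) (e ∘ toList) ⟩
      ∑ᴮ j (λ p → ∑ᴮ (n ∸ j) (λ z → e (toList (p Vec.++ z))))
        ≡⟨ ∑ᴮ-cong j (λ p → ∑ᴮ-cong (n ∸ j) (split p)) ⟩
      ∑ᴮ j (λ p → ∑ᴮ (n ∸ j) (λ z → 𝟙 (not (inK j (vₚ p))) * 𝟙 (accepted-from p z)))
        ≡⟨ ∑ᴮ-cong j (λ p → *-distribˡ-∑ᴮ (n ∸ j) (𝟙 (not (inK j (vₚ p)))) _) ⟨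
      ∑ᴮ j (escapeWeight j ∘ vₚ)    ∎
      where
      open ≡-Reasoning
      e : List Bool → ℕ
      e = 𝟙 ∘ escapesAt j
      vₚ : Vec Bool j → Fin w
      vₚ p = run B (toList p)
      accepted-from : Vec Bool j → Vec Bool (n ∸ j) → Bool
      accepted-from p z = lookup (acc B) (runFrom B j (toList z) (vₚ p))
      split : ∀ p z → e (toList (p Vec.++ z)) ≡ 𝟙 (not (inK j (vₚ p))) * 𝟙 (accepted-from p z)
      split p z = ≡.trans (cong₂ (λ u u′ → 𝟙 (not (inK j u) ∧ lookup (acc B) u′))
                                  (cong (run B) (take-toList-++ p z))
                                  (runFrom-toList-++ B p z (start B)))
                          (𝟙-∧ (not (inK j (vₚ p))) _)

    module _ {j Q R : ℕ}
             (bound : ∀ {v t} → ¬ T (inK j v) → T (lookup (acc B) t) → reachCount B j v ⁅ t ⁆ * Q ≤ R) where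

      escapeWeight-≤ : ∀ v → Q * escapeWeight j v ≤ ∣ acc B ∣ * R
      escapeWeight-≤ v with inK j v in inK-v≡
      ... | true  = ≤-trans (≤-reflexive (*-zeroʳ Q)) z≤n
      ... | false = begin
        Q * (1 * reachCount B j v (acc B))            ≡⟨ cong (Q *_) (*-identityˡ _) ⟩
        Q * reachCount B j v (acc B)                  ≡⟨ cong (Q *_) (reachCount-decompose B j v (acc B)) ⟩
        Q * ∑[ t < w ] (𝟙 (lookup (acc B) t) * r t)   ≡⟨ *-distribˡ-sum Q (λ t → 𝟙 (lookup (acc B) t) * r t) ⟩
        ∑[ t < w ] (Q * (𝟙 (lookup (acc B) t) * r t))
          ≡⟨ sum-cong-≗ (λ t → *-Comm.x∙yz≈y∙zx Q (𝟙 (lookup (acc B) t)) (r t)) ⟩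
        ∑[ t < w ] (𝟙 (lookup (acc B) t) * (r t * Q))
          ≤⟨ ∑-𝟙-weighted-≤ (acc B) (λ t → bound (subst T inK-v≡)) ⟩
        ∣ acc B ∣ * R                                 ∎
        where
        open ≤-Reasoning
        r : Fin w → ℕ
        r t = reachCount B j v ⁅ t ⁆

      escapeCount-≤ : j ≤ n → escapeCount j * Q ≤ 2 ^ j * (∣ acc B ∣ * R)
      escapeCount-≤ j≤n = begin
        escapeCount j * Q                                ≡⟨ *-comm _ Q ⟩
        Q * escapeCount j                                ≡⟨ cong (Q *_) (escapeCount-split j≤n) ⟩
        Q * ∑ᴮ j (escapeWeight j ∘ run B ∘ toList)       ≡⟨ *-distribˡ-∑ᴮ j Q _ ⟩
        ∑ᴮ j (λ p → Q * escapeWeight j (run B (toList p))) ≤⟨ ∑ᴮ-≤ j (escapeWeight-≤ ∘ run B ∘ toList) ⟩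
        2 ^ j * (∣ acc B ∣ * R)                          ∎
        where open ≤-Reasoning

    module _ (δ : ℚ) {p k : ℕ} .{{_ : NonZero k}} (hit : Hitter n (δ ℚ.* (+ 1 / k)) H)
             (↥δ≡p : ↥ δ ≡ + p) where

      -- The suffix program ignores the last j input bits, so its acceptance count carries a
      -- factor 2 ^ j, which cancels against 2 ^ n = 2 ^ j * 2 ^ (n ∸ j).
      reachCount-≤ : ∀ {j v t} → j ≤ n → ¬ T (inK j v) → T (lookup (acc B) t) →
                     reachCount B j v ⁅ t ⁆ * (↧ₙ δ * k) ≤ p * 2 ^ (n ∸ j)
      reachCount-≤ {j} {v} {t} j≤n v∉K t∈acc = *-cancelˡ-≤ (2 ^ j) {{m^n≢0 2 j}} (begin
        2 ^ j * (reachCount B j v ⁅ t ⁆ * Q) ≡⟨ *-assoc (2 ^ j) _ Q ⟨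
        2 ^ j * reachCount B j v ⁅ t ⁆ * Q   ≡⟨ cong (_* Q) (count-suffixProgram B j≤n v ⁅ t ⁆) ⟨
        ∑ᴮ n (𝟙 ∘ eval B′) * Q
          ≤⟨ /≤δ*1/k⇒ (∑ᴮ n (𝟙 ∘ eval B′)) (2 ^ n) k {{m^n≢0 2 n}} δ ↥δ≡p Pr≤ ⟩
        p * 2 ^ n                            ≡⟨ cong (p *_) (2^n≡2^j*2^[n∸j] j≤n) ⟩
        p * (2 ^ j * 2 ^ (n ∸ j))            ≡⟨ *-Comm.x∙yz≈y∙xz p (2 ^ j) _ ⟩
        2 ^ j * (p * 2 ^ (n ∸ j))            ∎)
        where
        open ≤-Reasoning
        Q = ↧ₙ δ * k
        B′ = suffixProgram B j v ⁅ t ⁆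
        Pr≤ : _/_ (+ ∑ᴮ n (𝟙 ∘ eval B′)) (2 ^ n) {{m^n≢0 2 n}} ℚ.≤ δ ℚ.* (+ 1 / k)
        Pr≤ = subst (ℚ._≤ δ ℚ.* (+ 1 / k)) (Pr≡∑ᴮ/2^n n (eval B′)) (Pr-suffixProgram≤ hit v∉K t∈acc)

      escapeCount-≤-hitter : ∀ {j} → j ≤ n → escapeCount j * (↧ₙ δ * k) ≤ ∣ acc B ∣ * (p * 2 ^ n)
      escapeCount-≤-hitter {j} j≤n = begin
        escapeCount j * (↧ₙ δ * k)              ≤⟨ escapeCount-≤ (reachCount-≤ j≤n) j≤n ⟩
        2 ^ j * (∣ acc B ∣ * (p * 2 ^ (n ∸ j))) ≡⟨ *-Comm.x∙yz≈y∙xz (2 ^ j) ∣ acc B ∣ _ ⟩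
        ∣ acc B ∣ * (2 ^ j * (p * 2 ^ (n ∸ j)))
          ≡⟨ cong (∣ acc B ∣ *_) (*-Comm.x∙yz≈y∙xz (2 ^ j) p _) ⟩
        ∣ acc B ∣ * (p * (2 ^ j * 2 ^ (n ∸ j)))
          ≡⟨ cong (λ m → ∣ acc B ∣ * (p * m)) (2^n≡2^j*2^[n∸j] j≤n) ⟨
        ∣ acc B ∣ * (p * 2 ^ n)
          ∎
        where open ≤-Reasoning

    module Simulation (ι : (i : ℕ) → Kpad i ⤖ Fin Kmax) (tr : (i : ℕ) → i < n → Bool → W i → W (suc i))
                      (isHit : IsHitTrans ι tr) (x : Vec Bool n) where
      open IsHitTrans isHit

      s : ℕ → Fin w
      s k = run B (take k (toList x))

      EscapedBy : ℕ → Set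
      EscapedBy k = Σ[ i ∈ ℕ ] i ≤ k × ¬ T (inK i (s i))

      -- A sink state (j , u) of B_H is only moved by the transition of layer j, so recording
      -- toℕ j < k keeps a parked run parked (field other of IsHitTrans).
      data Simulates (k : ℕ) (st : W k) : Set where
        tracking : ∀ {v} (v∈K : T (inK k v)) → v ≡ s k → st ≡ inj₁ (inj₁ (v , v∈K)) → Simulates k st
        parked   : ∀ {j u} → toℕ j < k → st ≡ inj₂ (j , u) → EscapedBy k → Simulates k st

      simulates-step : ∀ {k} (k<n : k < n) {st} →
                       Simulates k st → Simulates (suc k) (tr k k<n (lookup x (fromℕ< k<n)) st)
      simulates-step {k} k<n (parked j<k refl (i , i≤k , sᵢ∉K)) =
        parked (m<n⇒m<1+n j<k) (other k k<n _ _ _ (<⇒≢ j<k)) (i , m≤n⇒m≤1+n i≤k , sᵢ∉K)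
      simulates-step {k} k<n (tracking {v} v∈K refl refl)
        with T? (inK (suc k) (trans B (fromℕ< k<n) (lookup x (fromℕ< k<n)) v))
      ... | yes v′∈K = tracking v′∈K (sym (run-take-suc B x k<n)) (stayK k k<n _ v v∈K v′∈K)
      ... | no  v′∉K = parked layer<suc-k (leaveK k k<n _ v v∈K v′∉K)
                              (suc k , ≤-refl , v′∉K ∘ subst (T ∘ inK (suc k)) (run-take-suc B x k<n))
        where
        layer<suc-k : toℕ (layerIx k<n) < suc k
        layer<suc-k = ≤-reflexive (cong suc (toℕ-fromℕ< (m<n⇒m<1+n k<n)))

      simulates : (s₀∈K : T (inK 0 (start B))) → ∀ k (k≤n : k ≤ n) →
                  Simulates k (runH tr (inj₁ (inj₁ (start B , s₀∈K))) x k k≤n)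
      simulates s₀∈K zero    _   = tracking s₀∈K refl refl
      simulates s₀∈K (suc k) k<n = simulates-step k<n (simulates s₀∈K k (<⇒≤ k<n))

      evalH-cases : (evalH tr x ≡ eval B x) ⊎ (evalH tr x ≡ false × EscapedBy n)
      evalH-cases with T? (inK 0 (start B))
      ... | no  s₀∉K = inj₂ (refl , 0 , z≤n , s₀∉K)
      ... | yes s₀∈K with simulates s₀∈K n ≤-refl
      ...   | tracking _ v≡sₙ st≡  =
              inj₁ (≡.trans (cong (acceptH tr) st≡) (cong (lookup (acc B)) (≡.trans v≡sₙ (run-take-n B x))))
      ...   | parked _ st≡ escaped = inj₂ (cong (acceptH tr) st≡ , escaped)

      escapesAt-T : ∀ {j} → ¬ T (inK j (s j)) → T (eval B x) → T (escapesAt j (toList x))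
      escapesAt-T {j} sⱼ∉K accepted =
        Equivalence.from (T-∧ {not (inK j (s j))} {eval B x}) (¬T⇒T-not {inK j (s j)} sⱼ∉K , accepted)

      escaped-before-n : 0 < n → EscapedBy n → T (eval B x) → Σ[ j ∈ ℕ ] j < n × ¬ T (inK j (s j))
      escaped-before-n 0<n (j , j≤n , sⱼ∉K) accepted with m≤n⇒m<n∨m≡n j≤n | T? (inK 0 (start B))
      ... | inj₁ j<n  | _        = j , j<n , sⱼ∉K
      ... | inj₂ _    | no s₀∉K  = 0 , 0<n , s₀∉K
      ... | inj₂ refl | yes s₀∈K = contradiction (acc⊆Kₙ {0} {start B} s₀∈K sₙ∈acc) sⱼ∉K
        where
        sₙ∈acc : T (lookup (acc B) (s n))
        sₙ∈acc = subst (T ∘ lookup (acc B)) (sym (run-take-n B x)) accepted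

      𝟙-evalH≤𝟙-eval : 𝟙 (evalH tr x) ≤ 𝟙 (eval B x)
      𝟙-evalH≤𝟙-eval with evalH-cases
      ... | inj₁ e       = ≤-reflexive (cong 𝟙 e)
      ... | inj₂ (e , _) = subst (_≤ 𝟙 (eval B x)) (cong 𝟙 (sym e)) z≤n

      𝟙-eval≤𝟙-evalH+escapes : 0 < n →
        𝟙 (eval B x) ≤ 𝟙 (evalH tr x) + ∑[ j < n ] 𝟙 (escapesAt (toℕ j) (toList x))
      𝟙-eval≤𝟙-evalH+escapes 0<n with evalH-cases
      ... | inj₁ e             = ≤-trans (≤-reflexive (cong 𝟙 (sym e))) (m≤m+n _ _)
      ... | inj₂ (_ , escaped) =
        ≤-trans (𝟙-≤ (λ accepted → counted (escaped-before-n 0<n escaped accepted) accepted)) (m≤n+m _ _)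
        where
        counted : Σ[ j ∈ ℕ ] j < n × ¬ T (inK j (s j)) → T (eval B x) →
                  1 ≤ ∑[ j < n ] 𝟙 (escapesAt (toℕ j) (toList x))
        counted (j , j<n , sⱼ∉K) accepted = ≤-trans
          (≤-reflexive (sym (T⇒𝟙≡1 (subst (λ i → T (escapesAt i (toList x))) (sym (toℕ-fromℕ< j<n))
                                           (escapesAt-T {j} sⱼ∉K accepted)))))
          (≤-∑ (λ i → 𝟙 (escapesAt (toℕ i) (toList x))) (fromℕ< j<n))

    module _ (ι : (i : ℕ) → Kpad i ⤖ Fin Kmax) (tr : (i : ℕ) → i < n → Bool → W i → W (suc i))
             (isHit : IsHitTrans ι tr) where
      open Simulation ι tr isHit

      count-evalH≤count-eval : ∑ᴮ n (𝟙 ∘ evalH tr) ≤ ∑ᴮ n (𝟙 ∘ eval B)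
      count-evalH≤count-eval = ∑ᴮ-mono n 𝟙-evalH≤𝟙-eval

      count-eval≤count-evalH+escapes : 0 < n →
        ∑ᴮ n (𝟙 ∘ eval B) ≤ ∑ᴮ n (𝟙 ∘ evalH tr) + ∑[ j < n ] escapeCount (toℕ j)
      count-eval≤count-evalH+escapes 0<n = begin
        ∑ᴮ n (𝟙 ∘ eval B)
          ≤⟨ ∑ᴮ-mono n (λ x → 𝟙-eval≤𝟙-evalH+escapes x 0<n) ⟩
        ∑ᴮ n (λ x → 𝟙 (evalH tr x) + ∑[ j < n ] e j x)
          ≡⟨ ∑ᴮ-distrib-+ n (𝟙 ∘ evalH tr) _ ⟩
        ∑ᴮ n (𝟙 ∘ evalH tr) + ∑ᴮ n (λ x → ∑[ j < n ] e j x)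
          ≡⟨ cong (λ c → ∑ᴮ n (𝟙 ∘ evalH tr) + c) (∑ᴮ-∑ n e) ⟩
        ∑ᴮ n (𝟙 ∘ evalH tr) + ∑[ j < n ] escapeCount (toℕ j)
          ∎
        where
        open ≤-Reasoning
        e : Fin n → Vec Bool n → ℕ
        e j x = 𝟙 (escapesAt (toℕ j) (toList x))

      count-gap : ∀ {a} .{{_ : NonZero n}} .{{_ : NonZero a}} (δ : ℚ) {p} →
        Hitter n (δ ℚ.* _/_ (+ 1) (n * a) {{m*n≢0 n a}}) H → ↥ δ ≡ + p → ∣ acc B ∣ ≤ a →
        (∑ᴮ n (𝟙 ∘ eval B) ∸ ∑ᴮ n (𝟙 ∘ evalH tr)) * ↧ₙ δ ≤ p * 2 ^ n
      count-gap {a} δ {p} hit ↥δ≡p ∣acc∣≤a = *-cancelʳ-≤ _ _ (n * a) {{m*n≢0 n a}} (begin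
        (cB ∸ cH) * ↧ₙ δ * (n * a)           ≡⟨ *-assoc (cB ∸ cH) (↧ₙ δ) (n * a) ⟩
        (cB ∸ cH) * Q
          ≤⟨ *-monoˡ-≤ Q (m≤n+o⇒m∸n≤o cB cH (count-eval≤count-evalH+escapes (>-nonZero⁻¹ n))) ⟩
        (∑[ j < n ] escapeCount (toℕ j)) * Q ≡⟨ *-distribʳ-sum {n} Q (escapeCount ∘ toℕ) ⟩
        ∑[ j < n ] (escapeCount (toℕ j) * Q)
          ≤⟨ ∑-≤ n (λ j → escapeCount-≤-hitter δ {{m*n≢0 n a}} hit ↥δ≡p (<⇒≤ (toℕ<n j))) ⟩
        n * (∣ acc B ∣ * (p * 2 ^ n))        ≤⟨ *-monoʳ-≤ n (*-monoˡ-≤ (p * 2 ^ n) ∣acc∣≤a) ⟩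
        n * (a * (p * 2 ^ n))                ≡⟨ ≡.trans (sym (*-assoc n a _)) (*-comm (n * a) _) ⟩
        p * 2 ^ n * (n * a)                  ∎)
        where
        open ≤-Reasoning
        cB = ∑ᴮ n (𝟙 ∘ eval B)
        cH = ∑ᴮ n (𝟙 ∘ evalH tr)
        Q = ↧ₙ δ * (n * a)

open import Defs
open import Data.Nat using (ℕ; suc; NonZero) renaming (_*_ to _*ℕ_; _≤_ to _≤ℕ_; _<_ to _<ℕ_)
open import Data.Nat.Properties using (m*n≢0)
open import Data.Bool using (Bool)
open import Data.Vec using (Vec)
open import Data.List using (List)
open import Data.Fin using (Fin)
open import Data.Fin.Subset using () renaming (∣_∣ to size)
open import Data.Integer using (+_)
open import Data.Rational using (ℚ; 0ℚ; _/_; _*_; _-_; ∣_∣; _<_; _≤_)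
open import Function.Bundles using (_⤖_)

import Data.Nat as ℕ
open import Data.Nat.Properties using (m^n≢0)
open import Relation.Binary.PropositionalEquality using (subst₂; sym)
open Counting using (Pr≡∑ᴮ/2^n)
open Fractions using (↥≡+∣↥∣; ∣/-/∣≤δ)
open HitPrograms using (count-evalH≤count-eval; count-gap)

lemma3p4 : (n a : ℕ) {{_ : NonZero n}} {{_ : NonZero a}}
    (δ : ℚ) → 0ℚ < δ →
    (H : List (Vec Bool n)) →
    Hitter n (δ * _/_ (+ 1) (n *ℕ a) {{m*n≢0 n a}}) H →
    (w : ℕ) (B : PBP n w) → size (acc B) ≤ℕ a →
    (ι : (i : ℕ) → HitProgram.Kpad B H i ⤖ Fin (HitProgram.Kmax B H)) →
    (tr : (i : ℕ) → i <ℕ n → Bool →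
          HitProgram.W B H i → HitProgram.W B H (suc i)) →
    HitProgram.IsHitTrans B H ι tr →
    ∣ Pr n (HitProgram.evalH B H tr) - Pr n (eval B) ∣ ≤ δ
lemma3p4 n a δ 0<δ H hit w B ∣acc∣≤a ι tr isHit =
  subst₂ (λ x y → ∣ x - y ∣ ≤ δ) (sym (Pr≡∑ᴮ/2^n n (evalH tr))) (sym (Pr≡∑ᴮ/2^n n (eval B)))
    (∣/-/∣≤δ _ _ (2 ℕ.^ n) {{m^n≢0 2 n}} δ (↥≡+∣↥∣ 0<δ)
      (count-evalH≤count-eval B H ι tr isHit)
      (count-gap B H ι tr isHit δ hit (↥≡+∣↥∣ 0<δ) ∣acc∣≤a))
  where open HitProgram B H using (evalH)
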